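{- Let $G=(V,E)$ be a connected graph on $n\geq 4$ vertices with $V=\{p_1,\ldots,p_{n-1},q\}$, such that $p_1-p_2-\cdots-p_{n-1}$ is a path in $G$, and let $N(q)=\{p_{i_1},\ldots,p_{i_t}\}$. If $\psi_{n-1}(G)=2$ and $\psi_n(G)=0$, then: (1) $d(p_1)\geq 2$ and $d(p_{n-1})\geq 2$; (2) $p_1p_{n-1}\notin E$, $qp_1\notin E$, $qp_{n-1}\notin E$, and for all $i\in\{2,\ldots,n-2\}$, if $qp_i\in E$ then $qp_{i+1}\notin E$; (3) $p_1p_{i_j+1}\notin E$ and $p_{n-1}p_{i_j-1}\notin E$ for all $j\in\{1,\ldots,t\}$; (4) $p_1p_{i_j-1}\notin E$ for all $j$ such that $i_j>\min\{i_1,\ldots,i_t\}$, and $p_{n-1}p_{i_j+1}\notin E$ for all $j$ such that $i_j<\max\{i_1,\ldots,i_t\}$.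
   Context: All graphs are finite and simple. $d(v)$ denotes the degree and $N(v)$ the neighbourhood of a vertex $v$. For a graph $G=(V,E)$ and a positive integer $k$, a $k$-path vertex cover of $G$ is a set $S\subseteq V$ such that every path on $k$ vertices in $G$ contains at least one vertex of $S$, and $\psi_k(G)$ is the minimum cardinality of such a set. -}

module Defs where

open import Data.Nat using (ℕ; zero; suc; _≤_)
open import Data.Bool using (Bool; true; false)
open import Data.Fin using (Fin; toℕ; fromℕ) renaming (zero to fzero)
open import Data.Fin.Subset using (Subset; _∈_; ∣_∣)
open import Data.List using (length; filterᵇ; allFin)
open import Data.Product using (Σ; ∃; _×_; Σ-syntax)
open import Function.Definitions using (Injective)
open import Relation.Binary.PropositionalEquality using (_≡_)

record Graph (n : ℕ) : Set where
  field
    adj    : Fin n → Fin n → Bool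
    sym    : ∀ u v → adj u v ≡ adj v u
    irrefl : ∀ v → adj v v ≡ false
open Graph public

Edge : ∀ {n} → Graph n → Fin n → Fin n → Set
Edge G u v = adj G u v ≡ true

degree : ∀ {n} → Graph n → Fin n → ℕ
degree {n} G v = length (filterᵇ (adj G v) (allFin n))

Consecutive : ∀ {n k} → Graph n → (Fin k → Fin n) → Set
Consecutive {k = k} G f = ∀ (i j : Fin k) → toℕ j ≡ suc (toℕ i) → Edge G (f i) (f j)

record KPath {n} (G : Graph n) (k : ℕ) : Set where
  field
    vert   : Fin k → Fin n
    inj    : Injective _≡_ _≡_ vert
    consec : Consecutive G vert
open KPath public

IsKPathCover : ∀ {n} → Graph n → ℕ → Subset n → Set
IsKPathCover G k S = ∀ (P : KPath G k) → ∃ λ i → vert P i ∈ S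

ψ[_]_≡_ : ∀ {n} → ℕ → Graph n → ℕ → Set
ψ[_]_≡_ {n} k G m =
  (Σ[ S ∈ Subset n ] (IsKPathCover G k S × ∣ S ∣ ≡ m))
  × (∀ (S : Subset n) → IsKPathCover G k S → m ≤ ∣ S ∣)

Connected : ∀ {n} → Graph n → Set
Connected {n} G = ∀ (u v : Fin n) → ∃ λ (k : ℕ) → Σ[ f ∈ (Fin (suc k) → Fin n) ]
  (f fzero ≡ u × f (fromℕ k) ≡ v × Consecutive G f)

module Submission where

-- Since ψ_n(G) = 0, the empty set meets every path on n
-- vertices, so G has no Hamiltonian path.  Label q by 0 and p_i by i.  Each
-- configuration forbidden in (2)-(4) would let us reroute the path
-- p_1 - … - p_{n-1} through q: cut it into at most three blocks, reverse
-- some of them and reconnect them via q and the extra edge.  The result is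
-- a walk whose labels are a rearrangement of 0, 1, …, n-1, i.e. a
-- Hamiltonian path.  Part (1) uses ψ_{n-1}(G) = 2 instead: if p_1 had only
-- one neighbour b, then {b} would already meet every path on n-1 vertices.

open import Defs
open import Data.Nat using (ℕ; suc; _≤_; _<_; _∸_)
open import Data.Fin using (Fin)
open import Data.Product using (Σ; ∃; _×_; Σ-syntax)
open import Data.Sum using (_⊎_)
open import Relation.Nullary using (¬_)
open import Relation.Binary.PropositionalEquality using (_≡_; _≢_)

open import Data.Nat using (zero; _+_; z≤n; s≤s)
open import Data.Nat.Properties
  using (+-comm; +-assoc; +-∸-assoc; m∸n+n≡m; suc-injective; ≤-refl; ≤-trans; n≤1+n; m≤n+m;
         m≤n⇒m≤1+n; m≤n⇒m<n∨m≡n; _≤?_; ≰⇒>; <⇒≱; 1+n≰n)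
open import Data.Bool using (T; T?)
open import Data.Unit using (tt)
open import Data.Product using (_,_; proj₂)
open import Data.Sum using (inj₁; inj₂)
open import Data.Empty using (⊥; ⊥-elim)
open import Data.Fin using (toℕ; punchOut; inject₁) renaming (zero to fzero; suc to fsuc)
open import Data.Fin.Properties using (punchOut-injective; injective⇒≤; any?; toℕ-inject₁) renaming (_≟_ to _≟ᶠ_)
open import Data.Fin.Subset using (Subset; ⁅_⁆; _⊆_; ∣_∣) renaming (_∈_ to _∈ˢ_)
open import Data.Fin.Subset.Properties using (x∈⁅y⁆⇔x≡y; ∣⁅x⁆∣≡1; p⊆q⇒∣p∣≤∣q∣)
open import Data.List using (List; _∷_; _++_; [_]; length; lookup; applyUpTo; upTo; reverse; filterᵇ; allFin)
open import Data.List.Properties using (++-assoc; applyUpTo-∷ʳ; map-upTo; map-cong; unfold-reverse; length-upTo)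
open import Data.List.Membership.Propositional using () renaming (_∈_ to _∈ₗ_)
open import Data.List.Membership.Propositional.Properties using (∈-lookup; ∈-filter⁺; ∈-allFin)
open import Data.List.Relation.Unary.Any using (here; there)
open import Data.List.Relation.Unary.All as All using (All)
import Data.List.Relation.Unary.All.Properties as All
open import Data.List.Relation.Unary.AllPairs using (_∷_)
open import Data.List.Relation.Unary.Linked using (Linked; [-]; _∷_)
open import Data.List.Relation.Unary.Unique.Propositional using (Unique)
open import Data.List.Relation.Unary.Unique.Propositional.Properties using (upTo⁺)
open import Data.List.Relation.Binary.Permutation.Propositional
  using (_↭_; ↭-refl; ↭-sym; ↭-trans; ↭-reflexive; ↭-prep; ↭⇒↭ₛ; module PermutationReasoning)
open import Data.List.Relation.Binary.Permutation.Propositional.Properties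
  using (All-resp-↭; ↭-length; ++⁺ˡ; ++⁺ʳ; ++-comm; shift; shifts; ↭-reverse)
import Data.List.Relation.Binary.Permutation.Setoid.Properties as PermutationSetoid
open import Relation.Nullary using (yes; no)
open import Relation.Binary.PropositionalEquality
  using (refl; trans; cong; subst; subst₂; setoid; module ≡-Reasoning)
  renaming (sym to ≡-sym)
open import Function using (_∘_; Injective)
open import Function.Bundles using (Equivalence)

applyUpTo-cong : ∀ {A : Set} {f g : ℕ → A} → (∀ j → f j ≡ g j) → ∀ k → applyUpTo f k ≡ applyUpTo g k
applyUpTo-cong {f = f} {g} f≗g k = trans (≡-sym (map-upTo f k)) (trans (map-cong f≗g (upTo k)) (map-upTo g k))

applyUpTo-++ : ∀ {A : Set} (f : ℕ → A) k l → applyUpTo f (k + l) ≡ applyUpTo f k ++ applyUpTo (λ j → f (k + j)) l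
applyUpTo-++ f zero    l = refl
applyUpTo-++ f (suc k) l = cong (f 0 ∷_) (applyUpTo-++ (f ∘ suc) k l)

run : ℕ → ℕ → List ℕ
run a k = applyUpTo (_+ a) k

run-++ : ∀ a k l → run a (k + l) ≡ run a k ++ run (k + a) l
run-++ a k l = trans (applyUpTo-++ (_+ a) k l) (cong (run a k ++_) (applyUpTo-cong shifted l))
  where
  shifted : ∀ j → k + j + a ≡ j + (k + a)
  shifted j = trans (cong (_+ a) (+-comm k j)) (+-assoc j k a)

range : ℕ → ℕ → List ℕ
range a b = run a (b ∸ a)

range-++ : ∀ {a b c} → a ≤ b → b ≤ c → range a b ++ range b c ≡ range a c
range-++ {a} {b} {c} a≤b b≤c = begin
  run a (b ∸ a) ++ run b (c ∸ b)              ≡⟨ cong (λ x → run a (b ∸ a) ++ run x (c ∸ b)) (≡-sym (m∸n+n≡m a≤b)) ⟩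
  run a (b ∸ a) ++ run (b ∸ a + a) (c ∸ b)    ≡⟨ ≡-sym (run-++ a (b ∸ a) (c ∸ b)) ⟩
  run a (b ∸ a + (c ∸ b))                     ≡⟨ cong (run a) lengths ⟩
  run a (c ∸ a)                               ∎
  where
  open ≡-Reasoning
  lengths : b ∸ a + (c ∸ b) ≡ c ∸ a
  lengths = begin
    b ∸ a + (c ∸ b)   ≡⟨ +-comm (b ∸ a) (c ∸ b) ⟩
    c ∸ b + (b ∸ a)   ≡⟨ ≡-sym (+-∸-assoc (c ∸ b) a≤b) ⟩
    c ∸ b + b ∸ a     ≡⟨ cong (_∸ a) (m∸n+n≡m b≤c) ⟩
    c ∸ a             ∎

upTo-suc : ∀ N → upTo (suc N) ≡ 0 ∷ range 1 (suc N)
upTo-suc N = cong (0 ∷_) (applyUpTo-cong (λ j → +-comm 1 j) N)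

lookup-injective : ∀ {A : Set} {xs : List A} → Unique xs →
                   ∀ i j → lookup xs i ≡ lookup xs j → i ≡ j
lookup-injective {xs = _ ∷ _} _          fzero    fzero    _ = refl
lookup-injective {xs = _ ∷ _} (x≢ ∷ _)   fzero    (fsuc j) e = ⊥-elim (All.lookup x≢ (∈-lookup j) e)
lookup-injective {xs = _ ∷ _} (x≢ ∷ _)   (fsuc i) fzero    e = ⊥-elim (All.lookup x≢ (∈-lookup i) (≡-sym e))
lookup-injective {xs = _ ∷ _} (_ ∷ uniq) (fsuc i) (fsuc j) e = cong fsuc (lookup-injective uniq i j e)

lookup-linked : ∀ {A : Set} {R : A → A → Set} {xs : List A} → Linked R xs →
                ∀ i j → toℕ j ≡ suc (toℕ i) → R (lookup xs i) (lookup xs j)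
lookup-linked (r ∷ _)  fzero    (fsuc fzero)    _ = r
lookup-linked (_ ∷ rs) (fsuc i) (fsuc j)        e = lookup-linked rs i j (suc-injective e)
lookup-linked [-]      fzero    fzero           ()
lookup-linked (_ ∷ _)  fzero    fzero           ()
lookup-linked (_ ∷ _)  fzero    (fsuc (fsuc _)) ()
lookup-linked (_ ∷ _)  (fsuc _) fzero           ()

distinct-members : ∀ {A : Set} {x y : A} (xs : List A) → x ∈ₗ xs → y ∈ₗ xs → x ≢ y → 2 ≤ length xs
distinct-members (_ ∷ _)     (here refl) (here refl) x≢y = ⊥-elim (x≢y refl)
distinct-members (_ ∷ _ ∷ _) (here _)    (there _)   _   = s≤s (s≤s z≤n)
distinct-members (_ ∷ _ ∷ _) (there _)   (here _)    _   = s≤s (s≤s z≤n)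
distinct-members (_ ∷ xs)    (there x∈)  (there y∈)  x≢y = ≤-trans (distinct-members xs x∈ y∈ x≢y) (n≤1+n _)

module Walks {A : Set} (_~_ : A → A → Set) where

  data Walk : A → A → List A → Set where
    at     : ∀ a → Walk a a [ a ]
    _∷⟨_⟩_ : ∀ a {b c xs} → a ~ b → Walk b c xs → Walk a c (a ∷ xs)

  linked : ∀ {a b xs} → Walk a b xs → Linked _~_ xs
  linked (at a)                   = [-]
  linked (a ∷⟨ e ⟩ at b)          = e ∷ [-]
  linked (a ∷⟨ e ⟩ (b ∷⟨ e′ ⟩ w)) = e ∷ linked (b ∷⟨ e′ ⟩ w)

  infixr 5 _⟨_⟩_
  _⟨_⟩_ : ∀ {a b c d xs ys} → Walk a b xs → b ~ c → Walk c d ys → Walk a d (xs ++ ys)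
  at a          ⟨ e ⟩ w = a ∷⟨ e ⟩ w
  (a ∷⟨ e′ ⟩ v) ⟨ e ⟩ w = a ∷⟨ e′ ⟩ (v ⟨ e ⟩ w)

  reverseWalk : (∀ {a b} → a ~ b → b ~ a) → ∀ {a b xs} → Walk a b xs → Walk b a (reverse xs)
  reverseWalk ~-sym (at a)                   = at a
  reverseWalk ~-sym (_∷⟨_⟩_ a {xs = xs} e w) =
    subst (Walk _ a) (≡-sym (unfold-reverse a xs)) (reverseWalk ~-sym w ⟨ ~-sym e ⟩ at a)

member⇒1≤∣S∣ : ∀ {n} {S : Subset n} {x} → x ∈ˢ S → 1 ≤ ∣ S ∣
member⇒1≤∣S∣ {S = S} {x} x∈S = subst (_≤ ∣ S ∣) (∣⁅x⁆∣≡1 x) (p⊆q⇒∣p∣≤∣q∣ ⁅x⁆⊆S)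
  where
  ⁅x⁆⊆S : ⁅ x ⁆ ⊆ S
  ⁅x⁆⊆S y∈⁅x⁆ = subst (_∈ˢ S) (≡-sym (Equivalence.to x∈⁅y⁆⇔x≡y y∈⁅x⁆)) x∈S

-- An injection of Fin (suc k) into Fin (suc (suc k)) hits one of any two
-- distinct points: removing both points would leave only k values.
injection-hits : ∀ {k} {f : Fin (suc k) → Fin (suc (suc k))} → Injective _≡_ _≡_ f →
                 ∀ {a b} → a ≢ b → (∀ i → f i ≢ a) → (∀ i → f i ≢ b) → ⊥
injection-hits {k} {f} f-inj {a} {b} a≢b f≢a f≢b = 1+n≰n (injective⇒≤ h-inj)
  where
  a≢f : ∀ i → a ≢ f i
  a≢f i = f≢a i ∘ ≡-sym
  -- f with a removed from its codomain
  g : Fin (suc k) → Fin (suc k)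
  g i = punchOut (a≢f i)
  b′≢g : ∀ i → punchOut a≢b ≢ g i
  b′≢g i e = f≢b i (≡-sym (punchOut-injective a≢b (a≢f i) e))
  -- then b removed as well
  h : Fin (suc k) → Fin k
  h i = punchOut (b′≢g i)
  h-inj : Injective _≡_ _≡_ h
  h-inj {i} {j} e = f-inj (punchOut-injective (a≢f i) (a≢f j) (punchOut-injective (b′≢g i) (b′≢g j) e))

module _ {n : ℕ} (G : Graph n) where

  edge-sym : ∀ {u v} → Edge G u v → Edge G v u
  edge-sym {u} {v} e = trans (sym G v u) e

  edge⇒≢ : ∀ {u v} → Edge G u v → u ≢ v
  edge⇒≢ {u} e refl with () ← trans (≡-sym e) (irrefl G u)

  labelledPath : (P : ℕ → Fin n) (k : ℕ) → (∀ {i j} → i < k → j < k → P i ≡ P j → i ≡ j) →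
                 ∀ {L} → L ↭ upTo k → Linked (λ a b → Edge G (P a) (P b)) L → KPath G k
  labelledPath P k P-inj {L} L↭ L-linked = subst (KPath G) length-L path
    where
    length-L : length L ≡ k
    length-L = trans (↭-length L↭) (length-upTo k)
    L-bounded : All (_< k) L
    L-bounded = All-resp-↭ (↭-sym L↭) (All.applyUpTo⁺₁ (λ x → x) k (λ i<k → i<k))
    L-unique : Unique L
    L-unique = PermutationSetoid.Unique-resp-↭ (setoid ℕ) (↭⇒↭ₛ (↭-sym L↭)) (upTo⁺ k)
    bounded : ∀ i → lookup L i < k
    bounded i = All.lookup L-bounded (∈-lookup i)
    path : KPath G (length L)
    path = record
      { vert   = P ∘ lookup L
      ; inj    = λ {i} {j} e → lookup-injective L-unique i j (P-inj (bounded i) (bounded j) e)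
      ; consec = lookup-linked L-linked
      }

  path-neighbour : ∀ {k} (P : KPath G (suc (suc k))) i → ∃ λ j → Edge G (vert P i) (vert P j)
  path-neighbour P fzero    = fsuc fzero , consec P fzero (fsuc fzero) refl
  path-neighbour P (fsuc i) =
    inject₁ i , edge-sym (consec P (inject₁ i) (fsuc i) (cong suc (≡-sym (toℕ-inject₁ i))))

  neighbour∈ : ∀ {u v} → Edge G u v → v ∈ₗ filterᵇ (adj G u) (allFin n)
  neighbour∈ {u} {v} e = ∈-filter⁺ (λ w → T? (adj G u w)) (∈-allFin v) (subst T (≡-sym e) tt)

  unique-neighbour : ∀ {u b} → degree G u < 2 → Edge G u b → ∀ v → Edge G u v → v ≡ b
  unique-neighbour {u} {b} d<2 eb v ev with v ≟ᶠ b
  ... | yes v≡b = v≡b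
  ... | no  v≢b = ⊥-elim (<⇒≱ d<2 (distinct-members _ (neighbour∈ ev) (neighbour∈ eb) v≢b))

  -- If ψ_k(G) = 0 then G has no path on k vertices: a minimum cover is empty.
  ψ≡0⇒noPath : ∀ {k} → ψ[ k ] G ≡ 0 → ¬ KPath G k
  ψ≡0⇒noPath ((S , covers , ∣S∣≡0) , _) P with () ← subst (1 ≤_) ∣S∣≡0 (member⇒1≤∣S∣ (proj₂ (covers P)))

  connected⇒neighbour : Connected G → ∀ {u v} → u ≢ v → ∃ λ w → Edge G u w
  connected⇒neighbour conn {u} {v} u≢v with conn u v
  ... | zero  , f , f0≡u , f0≡v , _     = ⊥-elim (u≢v (trans (≡-sym f0≡u) f0≡v))
  ... | suc _ , f , f0≡u , _    , steps =
    f (fsuc fzero) , subst (λ x → Edge G x (f (fsuc fzero))) f0≡u (steps fzero (fsuc fzero) refl)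

module _ {k : ℕ} (G : Graph (suc (suc (suc k)))) where

  -- If b is the only neighbour of a, then {b} meets every path on |V|-1
  -- vertices: a path avoiding b also avoids a, so it would have to fit into
  -- the remaining |V|-2 vertices.
  pendant-cover : ∀ {a b} → Edge G a b → (∀ v → Edge G a v → v ≡ b) → IsKPathCover G (suc (suc k)) ⁅ b ⁆
  pendant-cover {a} {b} ab only-b P with any? (λ i → vert P i ≟ᶠ b)
  ... | yes (i , vert≡b) = i , Equivalence.from x∈⁅y⁆⇔x≡y vert≡b
  ... | no  avoids-b     = ⊥-elim (injection-hits (inj P) (edge⇒≢ G ab) avoids-a (λ i e → avoids-b (i , e)))
    where
    avoids-a : ∀ i → vert P i ≢ a
    avoids-a i refl with path-neighbour G P i
    ... | j , e = avoids-b (j , only-b (vert P j) e)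

  ψ≡2⇒degree≥2 : ψ[ suc (suc k) ] G ≡ 2 → ∀ {a b} → Edge G a b → 2 ≤ degree G a
  ψ≡2⇒degree≥2 (_ , minimal) {a} {b} ab with 2 ≤? degree G a
  ... | yes 2≤d = 2≤d
  ... | no  2≰d with s≤s () ← subst (2 ≤_) (∣⁅x⁆∣≡1 b) (minimal ⁅ b ⁆ (pendant-cover ab (unique-neighbour G (≰⇒> 2≰d) ab)))

-- The setting of the theorem, with N = M + 1 = n - 1: the vertices are q and
-- the distinct p_1, …, p_N, p_1 - … - p_N is a path, and G has no
-- Hamiltonian path.  Each lemma below refutes one configuration by
-- exhibiting a Hamiltonian walk.
module Rerouting (M : ℕ) (G : Graph (suc (suc M))) (p : ℕ → Fin (suc (suc M))) (q : Fin (suc (suc M)))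
  (p-injective : ∀ i j → 1 ≤ i → i ≤ suc M → 1 ≤ j → j ≤ suc M → p i ≡ p j → i ≡ j)
  (p≢q : ∀ i → 1 ≤ i → i ≤ suc M → p i ≢ q)
  (p-path : ∀ i → 1 ≤ i → suc i ≤ suc M → Edge G (p i) (p (suc i)))
  (no-hamiltonian : ¬ KPath G (suc (suc M))) where

  N : ℕ
  N = suc M

  P : ℕ → Fin (suc N)
  P zero    = q
  P (suc i) = p (suc i)

  P-injective : ∀ {i j} → i < suc N → j < suc N → P i ≡ P j → i ≡ j
  P-injective {zero}  {zero}  _         _         _ = refl
  P-injective {zero}  {suc j} _         (s≤s j≤N) e = ⊥-elim (p≢q (suc j) (s≤s z≤n) j≤N (≡-sym e))
  P-injective {suc i} {zero}  (s≤s i≤N) _         e = ⊥-elim (p≢q (suc i) (s≤s z≤n) i≤N e)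
  P-injective {suc i} {suc j} (s≤s i≤N) (s≤s j≤N) e = p-injective _ _ (s≤s z≤n) i≤N (s≤s z≤n) j≤N e

  _~_ : ℕ → ℕ → Set
  a ~ b = Edge G (P a) (P b)

  q~ : ∀ {j} → 1 ≤ j → Edge G q (p j) → 0 ~ j
  q~ (s≤s _) e = e

  ~q : ∀ {j} → 1 ≤ j → Edge G q (p j) → j ~ 0
  ~q (s≤s _) e = edge-sym G e

  p~ : ∀ {i j} → 1 ≤ i → 1 ≤ j → Edge G (p i) (p j) → i ~ j
  p~ (s≤s _) (s≤s _) e = e

  ~p : ∀ {i j} → 1 ≤ i → 1 ≤ j → Edge G (p i) (p j) → j ~ i
  ~p (s≤s _) (s≤s _) e = edge-sym G e

  open Walks _~_

  labels : List ℕ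
  labels = 0 ∷ range 1 (suc N)

  no-hamiltonian-walk : ∀ {a b L} → Walk a b L → L ↭ labels → ⊥
  no-hamiltonian-walk w L↭ =
    no-hamiltonian (labelledPath G P (suc N) P-injective (↭-trans L↭ (↭-reflexive (≡-sym (upTo-suc N)))) (linked w))

  cut₂ : ∀ {a} → 1 ≤ a → a ≤ suc N → 0 ∷ range 1 a ++ range a (suc N) ↭ labels
  cut₂ 1≤a a≤ = ↭-reflexive (cong (0 ∷_) (range-++ 1≤a a≤))

  cut₃ : ∀ {a b} → 1 ≤ a → a ≤ b → b ≤ suc N → 0 ∷ range 1 a ++ range a b ++ range b (suc N) ↭ labels
  cut₃ {a} 1≤a a≤b b≤ = ↭-reflexive (cong (0 ∷_)
    (trans (cong (range 1 a ++_) (range-++ a≤b b≤)) (range-++ 1≤a (≤-trans a≤b b≤))))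

  ascend : ∀ a k → 1 ≤ a → k + a ≤ N → Walk a (k + a) (run a (suc k))
  ascend a zero    _   _      = at a
  ascend a (suc k) 1≤a k+a<N =
    subst (Walk a (suc k + a)) (applyUpTo-∷ʳ (_+ a) (suc k))
      (ascend a k 1≤a (≤-trans (n≤1+n _) k+a<N) ⟨ p~ 1≤k+a (s≤s z≤n) (p-path (k + a) 1≤k+a k+a<N) ⟩ at (suc k + a))
    where
    1≤k+a : 1 ≤ k + a
    1≤k+a = ≤-trans 1≤a (m≤n+m a k)

  segment : ∀ a b → 1 ≤ a → a ≤ b → b ≤ N → Walk a b (range a (suc b))
  segment a b 1≤a a≤b b≤N =
    subst₂ (Walk a) (m∸n+n≡m a≤b) (cong (run a) (≡-sym (+-∸-assoc 1 a≤b)))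
      (ascend a (b ∸ a) 1≤a (subst (_≤ N) (≡-sym (m∸n+n≡m a≤b)) b≤N))

  reverse-segment : ∀ a b → 1 ≤ a → a ≤ b → b ≤ N → Walk b a (reverse (range a (suc b)))
  reverse-segment a b 1≤a a≤b b≤N = reverseWalk (edge-sym G) (segment a b 1≤a a≤b b≤N)

  1≤N : 1 ≤ N
  1≤N = s≤s z≤n

  -- (2) Otherwise q p_1 … p_N is Hamiltonian.
  no-qp₁ : ¬ Edge G q (p 1)
  no-qp₁ e = no-hamiltonian-walk (at 0 ⟨ e ⟩ segment 1 N ≤-refl 1≤N ≤-refl) ↭-refl

  -- (2) Otherwise p_1 … p_N q is Hamiltonian.
  no-qpN : ¬ Edge G q (p N)
  no-qpN e = no-hamiltonian-walk (segment 1 N ≤-refl 1≤N ≤-refl ⟨ ~q 1≤N e ⟩ at 0) (++-comm (range 1 (suc N)) [ 0 ])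

  -- (2) Otherwise p_1 … p_i q p_{i+1} … p_N is Hamiltonian.
  no-q-consecutive : ∀ i → 1 ≤ i → suc i ≤ N → Edge G q (p i) → ¬ Edge G q (p (suc i))
  no-q-consecutive i 1≤i i<N e e′ = no-hamiltonian-walk
    (segment 1 i ≤-refl 1≤i (≤-trans (n≤1+n i) i<N) ⟨ ~q 1≤i e ⟩ at 0 ⟨ q~ (s≤s z≤n) e′ ⟩ segment (suc i) N (s≤s z≤n) i<N ≤-refl)
    (begin
      X ++ 0 ∷ Y   ↭⟨ shift 0 X Y ⟩
      0 ∷ X ++ Y   ↭⟨ cut₂ (s≤s z≤n) (m≤n⇒m≤1+n i<N) ⟩
      labels       ∎)
    where
    open PermutationReasoning
    X Y : List ℕ
    X = range 1 (suc i)
    Y = range (suc i) (suc N)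

  -- (2) Once q has a neighbour p_j, j ≥ 2 (j = 1 is excluded above),
  -- otherwise q p_j … p_N p_1 … p_{j-1} is Hamiltonian.
  no-p₁pN : (∃ λ j → 1 ≤ j × j ≤ N × Edge G q (p j)) → ¬ Edge G (p 1) (p N)
  no-p₁pN (suc zero    , _ , _   , e) _  = no-qp₁ e
  no-p₁pN (suc (suc k) , _ , j≤N , e) e′ = no-hamiltonian-walk
    (at 0 ⟨ e ⟩ segment (suc (suc k)) N (s≤s z≤n) j≤N ≤-refl ⟨ ~p ≤-refl 1≤N e′ ⟩ segment 1 (suc k) ≤-refl (s≤s z≤n) (≤-trans (n≤1+n _) j≤N))
    (begin
      0 ∷ Y ++ X   ↭⟨ ↭-prep 0 (++-comm Y X) ⟩
      0 ∷ X ++ Y   ↭⟨ cut₂ (s≤s z≤n) (m≤n⇒m≤1+n j≤N) ⟩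
      labels       ∎)
    where
    open PermutationReasoning
    X Y : List ℕ
    X = range 1 (suc (suc k))
    Y = range (suc (suc k)) (suc N)

  -- (3) Otherwise q p_i … p_1 p_{i+1} … p_N is Hamiltonian.
  no-p₁-after-neighbour : ∀ i → 1 ≤ i → suc i ≤ N → Edge G q (p i) → ¬ Edge G (p 1) (p (suc i))
  no-p₁-after-neighbour i 1≤i i<N e e′ = no-hamiltonian-walk
    (at 0 ⟨ q~ 1≤i e ⟩ reverse-segment 1 i ≤-refl 1≤i (≤-trans (n≤1+n i) i<N) ⟨ p~ ≤-refl (s≤s z≤n) e′ ⟩ segment (suc i) N (s≤s z≤n) i<N ≤-refl)
    (begin
      0 ∷ reverse X ++ Y   ↭⟨ ↭-prep 0 (++⁺ʳ Y (↭-reverse X)) ⟩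
      0 ∷ X ++ Y           ↭⟨ cut₂ (s≤s z≤n) (m≤n⇒m≤1+n i<N) ⟩
      labels               ∎)
    where
    open PermutationReasoning
    X Y : List ℕ
    X = range 1 (suc i)
    Y = range (suc i) (suc N)

  -- (3) Otherwise p_1 … p_{i-1} p_N … p_i q is Hamiltonian.
  no-pN-before-neighbour : ∀ i → 2 ≤ i → i ≤ N → Edge G q (p i) → ¬ Edge G (p N) (p (i ∸ 1))
  no-pN-before-neighbour (suc k) (s≤s 1≤k) i≤N e e′ = no-hamiltonian-walk
    (segment 1 k ≤-refl 1≤k (≤-trans (n≤1+n k) i≤N) ⟨ ~p 1≤N 1≤k e′ ⟩ reverse-segment (suc k) N (s≤s z≤n) i≤N ≤-refl ⟨ ~q (s≤s z≤n) e ⟩ at 0)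
    (begin
      X ++ reverse Y ++ [ 0 ]   ↭⟨ ++⁺ˡ X (++-comm (reverse Y) [ 0 ]) ⟩
      X ++ 0 ∷ reverse Y        ↭⟨ ++⁺ˡ X (↭-prep 0 (↭-reverse Y)) ⟩
      X ++ 0 ∷ Y                ↭⟨ shift 0 X Y ⟩
      0 ∷ X ++ Y                ↭⟨ cut₂ (s≤s z≤n) (m≤n⇒m≤1+n i≤N) ⟩
      labels                    ∎)
    where
    open PermutationReasoning
    X Y : List ℕ
    X = range 1 (suc k)
    Y = range (suc k) (suc N)

  -- (4) If q ~ p_{i'} and q ~ p_i with i' < i - 1, otherwise
  -- p_{i'+1} … p_{i-1} p_1 … p_{i'} q p_i … p_N is Hamiltonian
  -- (for i' = i - 1 the neighbours of q would be consecutive).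
  no-p₁-before-later-neighbour : ∀ i i′ → 1 ≤ i′ → i′ < i → i ≤ N →
                                 Edge G q (p i) → Edge G q (p i′) → ¬ Edge G (p 1) (p (i ∸ 1))
  no-p₁-before-later-neighbour (suc k) i′ 1≤i′ (s≤s i′≤k) i≤N e e′ e″ with m≤n⇒m<n∨m≡n i′≤k
  ... | inj₂ refl = no-q-consecutive i′ 1≤i′ i≤N e′ e
  ... | inj₁ i′<k = no-hamiltonian-walk
    (segment (suc i′) k (s≤s z≤n) i′<k k≤N ⟨ ~p ≤-refl 1≤k e″ ⟩ segment 1 i′ ≤-refl 1≤i′ i′≤N ⟨ ~q 1≤i′ e′ ⟩
     at 0 ⟨ q~ (s≤s z≤n) e ⟩ segment (suc k) N (s≤s z≤n) i≤N ≤-refl)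
    (begin
      Y ++ X ++ 0 ∷ Z     ↭⟨ shifts Y X ⟩
      X ++ Y ++ 0 ∷ Z     ≡⟨ ≡-sym (++-assoc X Y (0 ∷ Z)) ⟩
      (X ++ Y) ++ 0 ∷ Z   ↭⟨ shift 0 (X ++ Y) Z ⟩
      0 ∷ (X ++ Y) ++ Z   ≡⟨ cong (0 ∷_) (++-assoc X Y Z) ⟩
      0 ∷ X ++ Y ++ Z     ↭⟨ cut₃ (s≤s z≤n) (s≤s i′≤k) (m≤n⇒m≤1+n i≤N) ⟩
      labels              ∎)
    where
    open PermutationReasoning
    k≤N : k ≤ N
    k≤N = ≤-trans (n≤1+n k) i≤N
    i′≤N : i′ ≤ N
    i′≤N = ≤-trans i′≤k k≤N
    1≤k : 1 ≤ k
    1≤k = ≤-trans 1≤i′ i′≤k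
    X Y Z : List ℕ
    X = range 1 (suc i′)
    Y = range (suc i′) (suc k)
    Z = range (suc k) (suc N)

  -- (4) If q ~ p_i and q ~ p_{i'} with i + 1 < i', otherwise
  -- p_1 … p_i q p_{i'} … p_N p_{i+1} … p_{i'-1} is Hamiltonian
  -- (for i' = i + 1 the neighbours of q would be consecutive).
  no-pN-after-earlier-neighbour : ∀ i i′ → 1 ≤ i → i < i′ → i′ ≤ N →
                                  Edge G q (p i) → Edge G q (p i′) → ¬ Edge G (p N) (p (suc i))
  no-pN-after-earlier-neighbour i (suc k) 1≤i (s≤s i≤k) i′≤N e e′ e″ with m≤n⇒m<n∨m≡n i≤k
  ... | inj₂ refl = no-q-consecutive i 1≤i i′≤N e e′
  ... | inj₁ i<k = no-hamiltonian-walk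
    (segment 1 i ≤-refl 1≤i i≤N ⟨ ~q 1≤i e ⟩ at 0 ⟨ q~ (s≤s z≤n) e′ ⟩
     segment (suc k) N (s≤s z≤n) i′≤N ≤-refl ⟨ p~ 1≤N (s≤s z≤n) e″ ⟩ segment (suc i) k (s≤s z≤n) i<k k≤N)
    (begin
      X ++ 0 ∷ Z ++ Y     ↭⟨ shift 0 X (Z ++ Y) ⟩
      0 ∷ X ++ Z ++ Y     ↭⟨ ↭-prep 0 (++⁺ˡ X (++-comm Z Y)) ⟩
      0 ∷ X ++ Y ++ Z     ↭⟨ cut₃ (s≤s z≤n) (s≤s i≤k) (m≤n⇒m≤1+n i′≤N) ⟩
      labels              ∎)
    where
    open PermutationReasoning
    k≤N : k ≤ N
    k≤N = ≤-trans (n≤1+n k) i′≤N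
    i≤N : i ≤ N
    i≤N = ≤-trans i≤k k≤N
    X Y Z : List ℕ
    X = range 1 (suc i)
    Y = range (suc i) (suc k)
    Z = range (suc k) (suc N)

mainTheorem10 : ∀ (n : ℕ) (G : Graph n) (p : ℕ → Fin n) (q : Fin n) →
    4 ≤ n →
    Connected G →
    -- p_1, ..., p_{n-1} are distinct and different from q
    (∀ i j → 1 ≤ i → i ≤ n ∸ 1 → 1 ≤ j → j ≤ n ∸ 1 → p i ≡ p j → i ≡ j) →
    (∀ i → 1 ≤ i → i ≤ n ∸ 1 → p i ≢ q) →
    -- V = {p_1, ..., p_{n-1}, q}
    (∀ (v : Fin n) → v ≡ q ⊎ (Σ[ i ∈ ℕ ] (1 ≤ i × i ≤ n ∸ 1 × v ≡ p i))) →
    -- p_1 - p_2 - ... - p_{n-1} is a path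
    (∀ i → 1 ≤ i → suc i ≤ n ∸ 1 → Edge G (p i) (p (suc i))) →
    ψ[ n ∸ 1 ] G ≡ 2 →
    ψ[ n ] G ≡ 0 →
    -- (1)
    (2 ≤ degree G (p 1) × 2 ≤ degree G (p (n ∸ 1)))
    -- (2)
    × (¬ Edge G (p 1) (p (n ∸ 1)) × ¬ Edge G q (p 1) × ¬ Edge G q (p (n ∸ 1))
       × (∀ i → 2 ≤ i → i ≤ n ∸ 2 → Edge G q (p i) → ¬ Edge G q (p (suc i))))
    -- (3)  (i ranges over the indices i_j with p_{i_j} ∈ N(q))
    × (∀ i → 1 ≤ i → i ≤ n ∸ 1 → Edge G q (p i) →
         (suc i ≤ n ∸ 1 → ¬ Edge G (p 1) (p (suc i)))
         × (2 ≤ i → ¬ Edge G (p (n ∸ 1)) (p (i ∸ 1))))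
    -- (4)
    × (∀ i i' → 1 ≤ i → i ≤ n ∸ 1 → 1 ≤ i' → i' ≤ n ∸ 1 →
         Edge G q (p i) → Edge G q (p i') →
         (i' < i → ¬ Edge G (p 1) (p (i ∸ 1)))
         × (i < i' → ¬ Edge G (p (n ∸ 1)) (p (suc i))))
mainTheorem10 (suc (suc (suc (suc m)))) G p q (s≤s (s≤s (s≤s (s≤s _)))) connected p-injective p≢q covered p-path ψ≡2 ψ≡0 =
  ( (ψ≡2⇒degree≥2 G ψ≡2 p₁p₂ , ψ≡2⇒degree≥2 G ψ≡2 pNpN-1)
  , (no-p₁pN q-neighbour , no-qp₁ , no-qpN , λ i 2≤i i≤N∸1 → no-q-consecutive i (≤-trans (n≤1+n 1) 2≤i) (s≤s i≤N∸1))
  , (λ i 1≤i i≤N e → (λ i<N → no-p₁-after-neighbour i 1≤i i<N e) , (λ 2≤i → no-pN-before-neighbour i 2≤i i≤N e))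
  , (λ i i′ 1≤i i≤N 1≤i′ i′≤N e e′ →
        (λ i′<i → no-p₁-before-later-neighbour i i′ 1≤i′ i′<i i≤N e e′)
      , (λ i<i′ → no-pN-after-earlier-neighbour i i′ 1≤i i<i′ i′≤N e e′)) )
  where
  open Rerouting (suc (suc m)) G p q p-injective p≢q p-path (ψ≡0⇒noPath G ψ≡0)

  p₁p₂ : Edge G (p 1) (p 2)
  p₁p₂ = p-path 1 (s≤s z≤n) (s≤s (s≤s z≤n))

  pNpN-1 : Edge G (p N) (p (N ∸ 1))
  pNpN-1 = edge-sym G (p-path (N ∸ 1) (s≤s z≤n) ≤-refl)

  q-neighbour : ∃ λ j → 1 ≤ j × j ≤ N × Edge G q (p j)
  q-neighbour with connected⇒neighbour G connected (λ q≡p₁ → p≢q 1 (s≤s z≤n) (s≤s z≤n) (≡-sym q≡p₁))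
  ... | w , qw with covered w
  ...   | inj₁ refl                   = ⊥-elim (edge⇒≢ G qw refl)
  ...   | inj₂ (j , 1≤j , j≤N , refl) = j , 1≤j , j≤N , qw
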